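{- Let $\mathcal{D}$ be the set of all Dyck paths, and for $D\in\mathcal{D}$ let $|D|$ be its semilength, $\mathrm{sp}(D)$ its number of symmetric peaks and $\mathrm{ap}(D)$ its number of asymmetric peaks. Then, as formal power series in $z$, $$\sum_{D\in\mathcal{D}}\mathrm{sp}(D)\,z^{|D|}=\frac{5z-1+(1-z)\sqrt{1-4z}}{2(1-z)\sqrt{1-4z}},\qquad \sum_{D\in\mathcal{D}}\mathrm{ap}(D)\,z^{|D|}=\frac{1-3z-(1-z)\sqrt{1-4z}}{(1-z)\sqrt{1-4z}}.$$
   Context: A Dyck path of semilength $n$ is a lattice path with steps $\mathbf{u}=(1,1)$ and $\mathbf{d}=(1,-1)$ from $(0,0)$ to $(2n,0)$ never going below the $x$-axis; $\mathcal{D}$ is the set of all Dyck paths (of all semilengths $n\ge 0$). Subpaths always mean runs of consecutive steps. A peak is an occurrence of $\mathbf{ud}$. Every peak extends to a unique maximal consecutive subsequence of the form $\mathbf{u}^i\mathbf{d}^j$ ($i,j\ge1$), its maximal mountain. The peak is symmetric if $i=j$ and asymmetric otherwise. -}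

module Defs where

open import Data.Bool using (Bool; true; false; _∧_; not; if_then_else_)
open import Data.Nat using (ℕ; zero; suc; _∸_; _≡ᵇ_)
import Data.Nat as ℕ
open import Data.Integer using (ℤ; +_; _+_; _-_; _*_; -_)
open import Data.List using (List; []; _∷_; length; reverse; take; drop; map; upTo; filter; concatMap; foldr)
open import Data.Nat.ListAction using (sum)
open import Relation.Binary.PropositionalEquality using (_≡_)

data Step : Set where
  u d : Step

words : ℕ → List (List Step)
words zero    = [] ∷ []
words (suc n) = concatMap (λ w → (u ∷ w) ∷ (d ∷ w) ∷ []) (words n)

dyckFrom : ℕ → List Step → Bool
dyckFrom zero    []      = true
dyckFrom (suc h) []      = false
dyckFrom h       (u ∷ w) = dyckFrom (suc h) w
dyckFrom zero    (d ∷ w) = false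
dyckFrom (suc h) (d ∷ w) = dyckFrom h w

isDyck : List Step → Bool
isDyck = dyckFrom zero

dyckPaths : ℕ → List (List Step)
dyckPaths n = foldr (λ w acc → if isDyck w then w ∷ acc else acc) [] (words (n ℕ.+ n))

leadingU : List Step → ℕ
leadingU (u ∷ w) = suc (leadingU w)
leadingU _       = zero

leadingD : List Step → ℕ
leadingD (d ∷ w) = suc (leadingD w)
leadingD _       = zero

peakAt : List Step → ℕ → Bool
peakAt w k with drop k w
... | u ∷ d ∷ _ = true
... | _         = false

-- for the peak at position k: i = length of the maximal run of u's ending at
-- position k, j = length of the maximal run of d's starting at position k+1
mountainUp : List Step → ℕ → ℕ
mountainUp w k = leadingU (reverse (take (suc k) w))

mountainDown : List Step → ℕ → ℕ
mountainDown w k = leadingD (drop (suc k) w)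

symmetricAt : List Step → ℕ → Bool
symmetricAt w k = mountainUp w k ≡ᵇ mountainDown w k

indicator : Bool → ℕ
indicator true  = 1
indicator false = 0

sp : List Step → ℕ
sp w = sum (map (λ k → indicator (peakAt w k ∧ symmetricAt w k)) (upTo (length w)))

ap : List Step → ℕ
ap w = sum (map (λ k → indicator (peakAt w k ∧ not (symmetricAt w k))) (upTo (length w)))

FPS : Set
FPS = ℕ → ℤ

sumℤ : List ℤ → ℤ
sumℤ = foldr _+_ (+ 0)

_⋆_ : FPS → FPS → FPS
(f ⋆ g) n = sumℤ (map (λ k → f k * g (n ∸ k)) (upTo (suc n)))

_⊕_ : FPS → FPS → FPS
(f ⊕ g) n = f n + g n

_⊖_ : FPS → FPS → FPS
(f ⊖ g) n = f n - g n

-- polynomial with given coefficient list (constant term first)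
poly : List ℤ → FPS
poly []       n       = + 0
poly (c ∷ cs) zero    = c
poly (c ∷ cs) (suc n) = poly cs n

_≋_ : FPS → FPS → Set
f ≋ g = ∀ n → f n ≡ g n

SP : FPS
SP n = + sum (map sp (dyckPaths n))

AP : FPS
AP n = + sum (map ap (dyckPaths n))

IsSqrt1-4z : FPS → Set
IsSqrt1-4z S = (S 0 ≡ + 1) × (S ⋆ S) ≋ poly (+ 1 ∷ - (+ 4) ∷ [])
  where open import Data.Product using (_×_)

module Submission where

-- Deleting a peak ud from a Dyck path of semilength m + 1 leaves a path of semilength m together
-- with the position 0 ≤ k ≤ 2m where the peak sat, and this is a bijection.  Hence the total
-- number of peaks is P(m+1) = (2m+1) C(m), and, since inserting a peak into v creates a symmetric
-- peak at exactly sp(v) + peaks(v) + 1 of the positions k, the total number of symmetric peaks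
-- obeys T(m+1) = T(m) + P(m) + C(m).  In series form P = z(2θC + C) and T = z(T + P + C), where
-- θ = z d/dz and the Catalan series satisfies C = 1 + zC² (cut a path at its first descent).
-- Power series over ℤ have no zero divisors, so the square root of 1 - 4z with constant term 1
-- is S = 1 - 2zC.  Differentiating C = 1 + zC² gives S·θC = zC², whence S·P = zC and
-- (1 - z)·S·T = zC(z + S); both identities follow by ring arithmetic, using ap = peaks - sp.

open import Defs
open import Data.Product using (_×_; _,_)
open import Data.List using ([]; _∷_)
open import Algebra.Bundles using (CommutativeRing)

module PathCounting where

  open import Data.Bool using (Bool; true; false; _∧_; not; if_then_else_)
  open import Data.Bool.Properties using (not-injective; not-involutive)
  open import Data.Nat using (ℕ; zero; suc; _+_; _*_; _≤_; _<_; z≤n; s≤s; _≡ᵇ_)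
  import Data.Nat.Properties as ℕₚ
  open import Data.Nat.ListAction using (sum)
  open import Data.List using (List; map; applyUpTo; upTo; length; take; drop; reverse; _++_; concatMap; foldr)
  open import Data.List.Properties using (map-upTo; reverse-++)
  open import Data.Product using (Σ-syntax)
  open import Algebra.Properties.CommutativeSemigroup ℕₚ.+-commutativeSemigroup using (interchange; x∙yz≈y∙xz)
  open import Relation.Binary.PropositionalEquality
  open ≡-Reasoning

  sumTo : ℕ → (ℕ → ℕ) → ℕ
  sumTo m F = sum (applyUpTo F m)

  sum-map-upTo : ∀ F m → sum (map F (upTo m)) ≡ sumTo m F
  sum-map-upTo F m = cong sum (map-upTo F m)

  sumTo-cong : ∀ m {F G} → (∀ k → k < m → F k ≡ G k) → sumTo m F ≡ sumTo m G
  sumTo-cong zero    F≡G = refl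
  sumTo-cong (suc m) F≡G = cong₂ _+_ (F≡G 0 (s≤s z≤n)) (sumTo-cong m (λ k k<m → F≡G (suc k) (s≤s k<m)))

  sumTo-+ : ∀ m F G → sumTo m (λ k → F k + G k) ≡ sumTo m F + sumTo m G
  sumTo-+ zero    F G = refl
  sumTo-+ (suc m) F G = trans (cong (F 0 + G 0 +_) (sumTo-+ m (λ k → F (suc k)) (λ k → G (suc k))))
                               (interchange (F 0) (G 0) (sumTo m (λ k → F (suc k))) (sumTo m (λ k → G (suc k))))

  sumTo-const : ∀ m c → sumTo m (λ _ → c) ≡ m * c
  sumTo-const zero    c = refl
  sumTo-const (suc m) c = cong (c +_) (sumTo-const m c)

  pathSum : ℕ → ℕ → (List Step → ℕ) → ℕ
  pathSum zero    zero    g = g []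
  pathSum zero    (suc h) g = 0
  pathSum (suc l) zero    g = pathSum l 1 (λ w → g (u ∷ w))
  pathSum (suc l) (suc h) g = pathSum l (suc (suc h)) (λ w → g (u ∷ w)) + pathSum l h (λ w → g (d ∷ w))

  pathSum-cong : ∀ l h {f g} → (∀ w → length w ≡ l → f w ≡ g w) → pathSum l h f ≡ pathSum l h g
  pathSum-cong zero    zero    f≡g = f≡g [] refl
  pathSum-cong zero    (suc h) f≡g = refl
  pathSum-cong (suc l) zero    f≡g = pathSum-cong l 1 (λ w p → f≡g (u ∷ w) (cong suc p))
  pathSum-cong (suc l) (suc h) f≡g =
    cong₂ _+_ (pathSum-cong l (suc (suc h)) (λ w p → f≡g (u ∷ w) (cong suc p)))
              (pathSum-cong l h (λ w p → f≡g (d ∷ w) (cong suc p)))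

  pathSum-+ : ∀ l h f g → pathSum l h (λ w → f w + g w) ≡ pathSum l h f + pathSum l h g
  pathSum-+ zero    zero    f g = refl
  pathSum-+ zero    (suc h) f g = refl
  pathSum-+ (suc l) zero    f g = pathSum-+ l 1 (λ w → f (u ∷ w)) (λ w → g (u ∷ w))
  pathSum-+ (suc l) (suc h) f g =
    trans (cong₂ _+_ (pathSum-+ l (suc (suc h)) fᵘ gᵘ) (pathSum-+ l h fᵈ gᵈ))
          (interchange (pathSum l (suc (suc h)) fᵘ) (pathSum l (suc (suc h)) gᵘ) (pathSum l h fᵈ) (pathSum l h gᵈ))
    where
    fᵘ gᵘ fᵈ gᵈ : List Step → ℕ
    fᵘ w = f (u ∷ w)
    gᵘ w = g (u ∷ w)
    fᵈ w = f (d ∷ w)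
    gᵈ w = g (d ∷ w)

  pathSum-* : ∀ l h c f → pathSum l h (λ w → c * f w) ≡ c * pathSum l h f
  pathSum-* zero    zero    c f = refl
  pathSum-* zero    (suc h) c f = sym (ℕₚ.*-zeroʳ c)
  pathSum-* (suc l) zero    c f = pathSum-* l 1 c (λ w → f (u ∷ w))
  pathSum-* (suc l) (suc h) c f =
    trans (cong₂ _+_ (pathSum-* l (suc (suc h)) c (λ w → f (u ∷ w))) (pathSum-* l h c (λ w → f (d ∷ w))))
          (sym (ℕₚ.*-distribˡ-+ c _ _))

  pathSum-zero : ∀ l h → pathSum l h (λ _ → 0) ≡ 0
  pathSum-zero l h = pathSum-* l h 0 (λ _ → 0)

  sum-words-suc : ∀ (g : List Step → ℕ) l →
    sum (map g (words (suc l))) ≡ sum (map (λ w → g (u ∷ w)) (words l)) + sum (map (λ w → g (d ∷ w)) (words l))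
  sum-words-suc g l = go (words l)
    where
    go : ∀ ws → sum (map g (concatMap (λ w → (u ∷ w) ∷ (d ∷ w) ∷ []) ws))
              ≡ sum (map (λ w → g (u ∷ w)) ws) + sum (map (λ w → g (d ∷ w)) ws)
    go []       = refl
    go (w ∷ ws) = trans (cong (λ s → g (u ∷ w) + (g (d ∷ w) + s)) (go ws))
                   (trans (sym (ℕₚ.+-assoc (g (u ∷ w)) (g (d ∷ w)) _)) (interchange (g (u ∷ w)) (g (d ∷ w)) _ _))

  sum-words-dyckFrom : ∀ l h g → sum (map (λ w → indicator (dyckFrom h w) * g w) (words l)) ≡ pathSum l h g
  sum-words-dyckFrom zero    zero    g = trans (ℕₚ.+-identityʳ (g [] + 0)) (ℕₚ.+-identityʳ (g []))
  sum-words-dyckFrom zero    (suc h) g = refl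
  sum-words-dyckFrom (suc l) zero    g =
    trans (sum-words-suc _ l) (trans (cong₂ _+_ (sum-words-dyckFrom l 1 _) (zeros (words l))) (ℕₚ.+-identityʳ _))
    where
    zeros : ∀ ws → sum (map (λ (w : List Step) → 0) ws) ≡ 0
    zeros []       = refl
    zeros (w ∷ ws) = zeros ws
  sum-words-dyckFrom (suc l) (suc h) g =
    trans (sum-words-suc _ l) (cong₂ _+_ (sum-words-dyckFrom l (suc (suc h)) _) (sum-words-dyckFrom l h _))

  dyckTotal : ℕ → (List Step → ℕ) → ℕ
  dyckTotal n f = pathSum (n + n) 0 f

  sum-dyckPaths : ∀ f n → sum (map f (dyckPaths n)) ≡ dyckTotal n f
  sum-dyckPaths f n = trans (filter-isDyck (words (n + n))) (sum-words-dyckFrom (n + n) 0 f)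
    where
    filter-isDyck : ∀ ws → sum (map f (foldr (λ w acc → if isDyck w then w ∷ acc else acc) [] ws))
                         ≡ sum (map (λ w → indicator (isDyck w) * f w) ws)
    filter-isDyck []       = refl
    filter-isDyck (w ∷ ws) with isDyck w
    ... | true  = cong₂ _+_ (sym (ℕₚ.+-identityʳ (f w))) (filter-isDyck ws)
    ... | false = filter-isDyck ws

  dyckTotal-suc : ∀ m f → dyckTotal (suc m) f ≡ pathSum (suc (suc (m + m))) 0 f
  dyckTotal-suc m f = cong (λ l → pathSum (suc l) 0 f) (ℕₚ.+-suc m m)

  isPeak : List Step → Bool
  isPeak (u ∷ d ∷ _) = true
  isPeak _           = false

  peakAt-drop : ∀ w k → peakAt w k ≡ isPeak (drop k w)
  peakAt-drop w k with drop k w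
  ... | []        = refl
  ... | u ∷ []    = refl
  ... | u ∷ u ∷ _ = refl
  ... | u ∷ d ∷ _ = refl
  ... | d ∷ _     = refl

  insertPeak : ℕ → List Step → List Step
  insertPeak zero    v       = u ∷ d ∷ v
  insertPeak (suc k) []      = u ∷ d ∷ []
  insertPeak (suc k) (x ∷ v) = x ∷ insertPeak k v

  peakSum : ℕ → (List Step → ℕ → ℕ) → List Step → ℕ
  peakSum m F w = sumTo m (λ k → indicator (isPeak (drop k w)) * F w k)

  insertionSum : ℕ → (List Step → ℕ → ℕ) → List Step → ℕ
  insertionSum m F v = sumTo m (λ k → F (insertPeak k v) k)

  peaks : List Step → ℕ
  peaks w = sumTo (length w) (λ k → indicator (isPeak (drop k w)))

  peaks-peakSum : ∀ w → peaks w ≡ peakSum (length w) (λ _ _ → 1) w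
  peaks-peakSum w = sumTo-cong (length w) (λ k _ → sym (ℕₚ.*-identityʳ (indicator (isPeak (drop k w)))))

  indicator-∧ : ∀ a b → indicator (a ∧ b) ≡ indicator a * indicator b
  indicator-∧ true  true  = refl
  indicator-∧ true  false = refl
  indicator-∧ false b     = refl

  sp-peakSum : ∀ w → sp w ≡ peakSum (length w) (λ w k → indicator (symmetricAt w k)) w
  sp-peakSum w = trans (sum-map-upTo _ (length w)) (sumTo-cong (length w) λ k _ →
    trans (cong (λ b → indicator (b ∧ symmetricAt w k)) (peakAt-drop w k)) (indicator-∧ (isPeak (drop k w)) (symmetricAt w k)))

  sp+ap≡peaks : ∀ w → sp w + ap w ≡ peaks w
  sp+ap≡peaks w = begin
    sp w + ap w
      ≡⟨ cong₂ _+_ (sum-map-upTo _ (length w)) (sum-map-upTo _ (length w)) ⟩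
    sumTo (length w) (λ k → indicator (peakAt w k ∧ symmetricAt w k)) + sumTo (length w) (λ k → indicator (peakAt w k ∧ not (symmetricAt w k)))
      ≡⟨ sumTo-+ (length w) _ _ ⟨
    sumTo (length w) (λ k → indicator (peakAt w k ∧ symmetricAt w k) + indicator (peakAt w k ∧ not (symmetricAt w k)))
      ≡⟨ sumTo-cong (length w) (λ k _ → trans (split (peakAt w k) (symmetricAt w k)) (cong indicator (peakAt-drop w k))) ⟩
    peaks w ∎
    where
    split : ∀ a b → indicator (a ∧ b) + indicator (a ∧ not b) ≡ indicator a
    split true  true  = refl
    split true  false = refl
    split false b     = refl

  removePeak : ∀ l h F → pathSum (2 + l) h (peakSum (2 + l) F) ≡ pathSum l h (insertionSum (1 + l) F)

  removePeak-head : ∀ l h (F : List Step → ℕ → ℕ) →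
    pathSum (2 + l) h (λ w → indicator (isPeak w) * F w 0) ≡ pathSum l h (λ v → F (u ∷ d ∷ v) 0)
  removePeak-head l zero    F = cong₂ _+_ (pathSum-zero l 2) (pathSum-cong l 0 λ v _ → ℕₚ.+-identityʳ _)
  removePeak-head l (suc h) F =
    trans (cong₂ _+_ (cong₂ _+_ (pathSum-zero l (3 + h)) (pathSum-cong l (suc h) λ v _ → ℕₚ.+-identityʳ _))
                     (pathSum-zero (suc l) h))
          (ℕₚ.+-identityʳ _)

  removePeak-tail : ∀ l h (F : List Step → ℕ → ℕ) →
    pathSum (2 + l) h (λ w → sumTo (1 + l) (λ k → indicator (isPeak (drop (suc k) w)) * F w (suc k)))
      ≡ pathSum l h (λ v → sumTo l (λ k → F (insertPeak (suc k) v) (suc k)))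
  removePeak-tail zero    zero                F = refl
  removePeak-tail zero    (suc zero)          F = refl
  removePeak-tail zero    (suc (suc zero))    F = refl
  removePeak-tail zero    (suc (suc (suc h))) F = refl
  removePeak-tail (suc l) zero                F = removePeak l 1 (λ w k → F (u ∷ w) (suc k))
  removePeak-tail (suc l) (suc h)             F =
    cong₂ _+_ (removePeak l (2 + h) (λ w k → F (u ∷ w) (suc k))) (removePeak l h (λ w k → F (d ∷ w) (suc k)))

  removePeak l h F = begin
    pathSum (2 + l) h (peakSum (2 + l) F)
      ≡⟨ pathSum-+ (2 + l) h _ _ ⟩
    pathSum (2 + l) h (λ w → indicator (isPeak w) * F w 0)
      + pathSum (2 + l) h (λ w → sumTo (1 + l) (λ k → indicator (isPeak (drop (suc k) w)) * F w (suc k)))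
      ≡⟨ cong₂ _+_ (removePeak-head l h F) (removePeak-tail l h F) ⟩
    pathSum l h (λ v → F (u ∷ d ∷ v) 0) + pathSum l h (λ v → sumTo l (λ k → F (insertPeak (suc k) v) (suc k)))
      ≡⟨ pathSum-+ l h _ _ ⟨
    pathSum l h (insertionSum (1 + l) F) ∎

  trailingU : List Step → ℕ
  trailingU w = leadingU (reverse w)

  trailingU-∷ʳu : ∀ w → trailingU (w ++ u ∷ []) ≡ suc (trailingU w)
  trailingU-∷ʳu w = cong leadingU (reverse-++ w (u ∷ []))

  trailingU-∷ʳd : ∀ w → trailingU (w ++ d ∷ []) ≡ 0
  trailingU-∷ʳd w = cong leadingU (reverse-++ w (d ∷ []))

  take-insertPeak : ∀ k v → k ≤ length v → take (suc k) (insertPeak k v) ≡ take k v ++ u ∷ []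
  take-insertPeak zero    v       _         = refl
  take-insertPeak (suc k) (x ∷ v) (s≤s k≤n) = cong (x ∷_) (take-insertPeak k v k≤n)

  drop-insertPeak : ∀ k v → k ≤ length v → drop (suc k) (insertPeak k v) ≡ d ∷ drop k v
  drop-insertPeak zero    v       _         = refl
  drop-insertPeak (suc k) (x ∷ v) (s≤s k≤n) = drop-insertPeak k v k≤n

  symmetricAt-insertPeak : ∀ k v → k ≤ length v →
    symmetricAt (insertPeak k v) k ≡ (trailingU (take k v) ≡ᵇ leadingD (drop k v))
  symmetricAt-insertPeak k v k≤n = cong₂ _≡ᵇ_
    (trans (cong trailingU (take-insertPeak k v k≤n)) (trailingU-∷ʳu (take k v)))
    (cong leadingD (drop-insertPeak k v k≤n))

  stepAt : ∀ k v → k < length v → Σ[ x ∈ Step ] Σ[ rest ∈ List Step ]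
    drop k v ≡ x ∷ rest × take (suc k) v ≡ take k v ++ x ∷ [] × drop (suc k) v ≡ rest
  stepAt zero    (x ∷ v) _         = x , v , refl , refl , refl
  stepAt (suc k) (y ∷ v) (s≤s k<n) with stepAt k v k<n
  ... | x , rest , drop≡ , take≡ , drop′≡ = x , rest , drop≡ , cong (y ∷_) take≡ , drop′≡

  isDescentEnd : List Step → Bool
  isDescentEnd (d ∷ w) = 0 ≡ᵇ leadingD w
  isDescentEnd _       = false

  -- symmetricAt v k compares the run of up steps ending at k with the run of down steps after k;
  -- away from the peaks of v it holds exactly at a down step not followed by another down step.
  symmetricAt-split : ∀ k v → k < length v →
    indicator (symmetricAt v k) ≡ indicator (isPeak (drop k v)) * indicator (symmetricAt v k) + indicator (isDescentEnd (drop k v))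
  symmetricAt-split k v k<n with stepAt k v k<n
  ... | x , rest , drop≡ , take≡ , drop′≡ rewrite drop≡ | take≡ | drop′≡ = cases x rest
    where
    cases : ∀ x rest → indicator (trailingU (take k v ++ x ∷ []) ≡ᵇ leadingD rest)
      ≡ indicator (isPeak (x ∷ rest)) * indicator (trailingU (take k v ++ x ∷ []) ≡ᵇ leadingD rest) + indicator (isDescentEnd (x ∷ rest))
    cases u rest rewrite trailingU-∷ʳu (take k v) = upStep rest
      where
      upStep : ∀ rest → indicator (suc (trailingU (take k v)) ≡ᵇ leadingD rest)
        ≡ indicator (isPeak (u ∷ rest)) * indicator (suc (trailingU (take k v)) ≡ᵇ leadingD rest) + 0
      upStep []      = refl
      upStep (u ∷ _) = refl
      upStep (d ∷ _) = sym (trans (ℕₚ.+-identityʳ _) (ℕₚ.*-identityˡ _))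
    cases d rest rewrite trailingU-∷ʳd (take k v) = refl

  -- Every maximal run of down steps, except one at the very start, begins right after a peak.
  descentEnds : ∀ v → indicator (0 ≡ᵇ leadingD v) + sumTo (length v) (λ k → indicator (isDescentEnd (drop k v))) ≡ peaks v + 1
  descentEnds []          = refl
  descentEnds (d ∷ v)     = descentEnds v
  descentEnds (u ∷ [])    = refl
  descentEnds (u ∷ u ∷ v) = descentEnds (u ∷ v)
  descentEnds (u ∷ d ∷ v) = cong suc (descentEnds (d ∷ v))

  symmetricInsertions : ∀ v → insertionSum (suc (length v)) (λ w k → indicator (symmetricAt w k)) v ≡ sp v + peaks v + 1
  symmetricInsertions v = begin
    insertionSum (suc (length v)) (λ w k → indicator (symmetricAt w k)) v
      ≡⟨ sumTo-cong (suc (length v)) (λ k k≤n → cong indicator (symmetricAt-insertPeak k v (ℕₚ.≤-pred k≤n))) ⟩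
    I + sumTo (length v) (λ k → indicator (symmetricAt v k))
      ≡⟨ cong (I +_) (trans (sumTo-cong (length v) (λ k → symmetricAt-split k v)) (sumTo-+ (length v) _ _)) ⟩
    I + (Sp + E)    ≡⟨ x∙yz≈y∙xz I Sp E ⟩
    Sp + (I + E)    ≡⟨ cong₂ (λ a b → a + b) (sym (sp-peakSum v)) (descentEnds v) ⟩
    sp v + (peaks v + 1) ≡⟨ ℕₚ.+-assoc (sp v) (peaks v) 1 ⟨
    sp v + peaks v + 1 ∎
    where
    I = indicator (0 ≡ᵇ leadingD v)
    Sp = sumTo (length v) (λ k → indicator (isPeak (drop k v)) * indicator (symmetricAt v k))
    E = sumTo (length v) (λ k → indicator (isDescentEnd (drop k v)))

  catalan : ℕ → ℕ
  catalan n = dyckTotal n (λ _ → 1)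

  totalPeaks-suc : ∀ m → dyckTotal (suc m) peaks ≡ suc (m + m) * catalan m
  totalPeaks-suc m = begin
    dyckTotal (suc m) peaks                               ≡⟨ dyckTotal-suc m peaks ⟩
    pathSum (2 + (m + m)) 0 peaks
      ≡⟨ pathSum-cong (2 + (m + m)) 0 {g = peakSum (2 + (m + m)) (λ _ _ → 1)}
                      (λ w len≡ → trans (peaks-peakSum w) (cong (λ n → peakSum n (λ _ _ → 1) w) len≡)) ⟩
    pathSum (2 + (m + m)) 0 (peakSum (2 + (m + m)) (λ _ _ → 1))  ≡⟨ removePeak (m + m) 0 (λ _ _ → 1) ⟩
    pathSum (m + m) 0 (insertionSum (1 + (m + m)) (λ _ _ → 1))   ≡⟨ pathSum-cong (m + m) 0 (λ _ _ → sumTo-const (1 + (m + m)) 1) ⟩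
    pathSum (m + m) 0 (λ _ → suc (m + m) * 1)             ≡⟨ pathSum-* (m + m) 0 (suc (m + m)) (λ _ → 1) ⟩
    suc (m + m) * catalan m                               ∎

  totalSp-suc : ∀ m → dyckTotal (suc m) sp ≡ dyckTotal m sp + dyckTotal m peaks + catalan m
  totalSp-suc m = begin
    dyckTotal (suc m) sp                                  ≡⟨ dyckTotal-suc m sp ⟩
    pathSum (2 + (m + m)) 0 sp
      ≡⟨ pathSum-cong (2 + (m + m)) 0 {g = peakSum (2 + (m + m)) symmetric}
                      (λ w len≡ → trans (sp-peakSum w) (cong (λ n → peakSum n symmetric w) len≡)) ⟩
    pathSum (2 + (m + m)) 0 (peakSum (2 + (m + m)) symmetric)  ≡⟨ removePeak (m + m) 0 symmetric ⟩
    pathSum (m + m) 0 (insertionSum (1 + (m + m)) symmetric)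
      ≡⟨ pathSum-cong (m + m) 0 (λ v len≡ → trans (cong (λ n → insertionSum (suc n) symmetric v) (sym len≡))
                                                  (symmetricInsertions v)) ⟩
    pathSum (m + m) 0 (λ v → sp v + peaks v + 1)
      ≡⟨ trans (pathSum-+ (m + m) 0 (λ v → sp v + peaks v) (λ _ → 1)) (cong (_+ catalan m) (pathSum-+ (m + m) 0 sp peaks)) ⟩
    dyckTotal m sp + dyckTotal m peaks + catalan m        ∎
    where
    symmetric : List Step → ℕ → ℕ
    symmetric w k = indicator (symmetricAt w k)

  totalSp+totalAp : ∀ n → dyckTotal n sp + dyckTotal n ap ≡ dyckTotal n peaks
  totalSp+totalAp n = trans (sym (pathSum-+ (n + n) 0 sp ap)) (pathSum-cong (n + n) 0 (λ w _ → sp+ap≡peaks w))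

  dyckCount : ℕ → ℕ → ℕ
  dyckCount l h = pathSum l h (λ _ → 1)

  even : ℕ → Bool
  even zero    = true
  even (suc n) = not (even n)

  dyckCount-parity : ∀ l h → even l ≡ not (even h) → dyckCount l h ≡ 0
  dyckCount-parity zero    zero    ()
  dyckCount-parity zero    (suc h) _ = refl
  dyckCount-parity (suc l) zero    p = dyckCount-parity l 1 (not-injective p)
  dyckCount-parity (suc l) (suc h) p = cong₂ _+_
    (dyckCount-parity l (suc (suc h)) (trans (not-injective p) (sym (not-involutive (not (even h))))))
    (dyckCount-parity l h (not-injective p))

  even-double : ∀ k → even (k + k) ≡ true
  even-double zero    = refl
  even-double (suc k) = begin
    even (suc k + suc k)    ≡⟨ cong (λ n → not (even n)) (ℕₚ.+-suc k k) ⟩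
    not (not (even (k + k))) ≡⟨ not-involutive (even (k + k)) ⟩
    even (k + k)            ≡⟨ even-double k ⟩
    true                    ∎

  dyckCount-odd : ∀ k → dyckCount (suc (k + k)) 0 ≡ 0
  dyckCount-odd k = dyckCount-parity (suc (k + k)) 0 (cong not (even-double k))

module FormalPowerSeries where

  open import Data.Nat as ℕ using (ℕ; zero; suc; _≤_; z≤n; s≤s)
  import Data.Nat.Properties as ℕₚ
  open import Data.Integer as ℤ using (ℤ; +_; -_)
  import Data.Integer.Properties as ℤₚ
  open import Data.Integer.Tactic.RingSolver using (solve-∀)
  open import Data.List.Properties using (map-applyUpTo; map-upTo)
  open import Data.Sum using (inj₁; inj₂)
  open import Data.Maybe using (Maybe; just; nothing)
  open import Level using (0ℓ)
  open import Relation.Nullary using (yes; no; contradiction)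
  open import Relation.Binary.PropositionalEquality
  open import Algebra.Structures using (IsCommutativeRing)
  open import Algebra.Solver.Ring.AlmostCommutativeRing
    using (AlmostCommutativeRing; fromCommutativeRing; _-Raw-AlmostCommutative⟶_)
  import Algebra.Solver.Ring
  open ≡-Reasoning

  0ₛ 1ₛ X : FPS
  0ₛ = poly []
  1ₛ = poly (+ 1 ∷ [])
  X  = poly (+ 0 ∷ + 1 ∷ [])

  negₛ : FPS → FPS
  negₛ f n = - f n

  tail : FPS → FPS
  tail f n = f (suc n)

  ⋆-suc : ∀ f g n → (f ⋆ g) (suc n) ≡ f 0 ℤ.* g (suc n) ℤ.+ (tail f ⋆ g) n
  ⋆-suc f g n = cong (λ xs → f 0 ℤ.* g (suc n) ℤ.+ sumℤ xs)
    (trans (map-applyUpTo suc (λ k → f k ℤ.* g (suc n ℕ.∸ k)) (suc n))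
           (sym (map-upTo (λ k → f (suc k) ℤ.* g (n ℕ.∸ k)) (suc n))))

  AgreeUpTo : ℕ → FPS → FPS → Set
  AgreeUpTo n f g = ∀ m → m ≤ n → f m ≡ g m

  AgreeUpTo-zero : ∀ {f g} → f 0 ≡ g 0 → AgreeUpTo 0 f g
  AgreeUpTo-zero eq .0 z≤n = eq

  AgreeUpTo-suc : ∀ {n f g} → AgreeUpTo n f g → f (suc n) ≡ g (suc n) → AgreeUpTo (suc n) f g
  AgreeUpTo-suc {n} f≈g eq m m≤1+n with ℕₚ.m≤n⇒m<n∨m≡n m≤1+n
  ... | inj₁ (s≤s m≤n) = f≈g m m≤n
  ... | inj₂ refl      = eq

  ⋆-agree : ∀ n {f f′ g g′} → AgreeUpTo n f f′ → AgreeUpTo n g g′ → (f ⋆ g) n ≡ (f′ ⋆ g′) n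
  ⋆-agree zero    f≈ g≈ = cong₂ (λ a b → a ℤ.* b ℤ.+ + 0) (f≈ 0 z≤n) (g≈ 0 z≤n)
  ⋆-agree (suc n) {f} {f′} {g} {g′} f≈ g≈ = begin
    (f ⋆ g) (suc n)                          ≡⟨ ⋆-suc f g n ⟩
    f 0 ℤ.* g (suc n) ℤ.+ (tail f ⋆ g) n
      ≡⟨ cong₂ ℤ._+_ (cong₂ ℤ._*_ (f≈ 0 z≤n) (g≈ (suc n) ℕₚ.≤-refl))
                     (⋆-agree n (λ m m≤n → f≈ (suc m) (s≤s m≤n)) (λ m m≤n → g≈ m (ℕₚ.m≤n⇒m≤1+n m≤n))) ⟩
    f′ 0 ℤ.* g′ (suc n) ℤ.+ (tail f′ ⋆ g′) n ≡⟨ ⋆-suc f′ g′ n ⟨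
    (f′ ⋆ g′) (suc n)                        ∎

  ⋆-cong : ∀ {f f′ g g′} → f ≋ f′ → g ≋ g′ → (f ⋆ g) ≋ (f′ ⋆ g′)
  ⋆-cong f≋ g≋ n = ⋆-agree n (λ m _ → f≋ m) (λ m _ → g≋ m)

  ⋆-sucʳ : ∀ f g n → (f ⋆ g) (suc n) ≡ (f ⋆ tail g) n ℤ.+ f (suc n) ℤ.* g 0
  ⋆-sucʳ f g zero = shuffle (f 0) (g 1) (f 1) (g 0)
    where
    shuffle : ∀ a b c d → a ℤ.* b ℤ.+ (c ℤ.* d ℤ.+ + 0) ≡ (a ℤ.* b ℤ.+ + 0) ℤ.+ c ℤ.* d
    shuffle = solve-∀
  ⋆-sucʳ f g (suc n) = begin
    (f ⋆ g) (suc (suc n))                                                   ≡⟨ ⋆-suc f g (suc n) ⟩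
    f 0 ℤ.* g (suc (suc n)) ℤ.+ (tail f ⋆ g) (suc n)
      ≡⟨ cong (λ x → f 0 ℤ.* g (suc (suc n)) ℤ.+ x) (⋆-sucʳ (tail f) g n) ⟩
    f 0 ℤ.* g (suc (suc n)) ℤ.+ ((tail f ⋆ tail g) n ℤ.+ f (suc (suc n)) ℤ.* g 0) ≡⟨ ℤₚ.+-assoc (f 0 ℤ.* g (suc (suc n))) _ _ ⟨
    f 0 ℤ.* g (suc (suc n)) ℤ.+ (tail f ⋆ tail g) n ℤ.+ f (suc (suc n)) ℤ.* g 0
      ≡⟨ cong (ℤ._+ f (suc (suc n)) ℤ.* g 0) (⋆-suc f (tail g) n) ⟨
    (f ⋆ tail g) (suc n) ℤ.+ f (suc (suc n)) ℤ.* g 0                        ∎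

  ⋆-comm : ∀ f g → (f ⋆ g) ≋ (g ⋆ f)
  ⋆-comm f g zero    = cong (ℤ._+ + 0) (ℤₚ.*-comm (f 0) (g 0))
  ⋆-comm f g (suc n) = begin
    (f ⋆ g) (suc n)                        ≡⟨ ⋆-suc f g n ⟩
    f 0 ℤ.* g (suc n) ℤ.+ (tail f ⋆ g) n   ≡⟨ cong₂ ℤ._+_ (ℤₚ.*-comm (f 0) (g (suc n))) (⋆-comm (tail f) g n) ⟩
    g (suc n) ℤ.* f 0 ℤ.+ (g ⋆ tail f) n   ≡⟨ ℤₚ.+-comm _ ((g ⋆ tail f) n) ⟩
    (g ⋆ tail f) n ℤ.+ g (suc n) ℤ.* f 0   ≡⟨ ⋆-sucʳ g f n ⟨
    (g ⋆ f) (suc n)                        ∎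

  distribʳ-interchange : ∀ a b c x y → (a ℤ.+ b) ℤ.* c ℤ.+ (x ℤ.+ y) ≡ (a ℤ.* c ℤ.+ x) ℤ.+ (b ℤ.* c ℤ.+ y)
  distribʳ-interchange = solve-∀

  ⋆-distribʳ : ∀ f g h → ((f ⊕ g) ⋆ h) ≋ ((f ⋆ h) ⊕ (g ⋆ h))
  ⋆-distribʳ f g h zero    = distribʳ-interchange (f 0) (g 0) (h 0) (+ 0) (+ 0)
  ⋆-distribʳ f g h (suc n) = begin
    ((f ⊕ g) ⋆ h) (suc n)                                                  ≡⟨ ⋆-suc (f ⊕ g) h n ⟩
    (f 0 ℤ.+ g 0) ℤ.* h (suc n) ℤ.+ ((tail f ⊕ tail g) ⋆ h) n
      ≡⟨ cong (λ x → (f 0 ℤ.+ g 0) ℤ.* h (suc n) ℤ.+ x) (⋆-distribʳ (tail f) (tail g) h n) ⟩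
    (f 0 ℤ.+ g 0) ℤ.* h (suc n) ℤ.+ ((tail f ⋆ h) n ℤ.+ (tail g ⋆ h) n)    ≡⟨ distribʳ-interchange (f 0) (g 0) (h (suc n)) _ _ ⟩
    (f 0 ℤ.* h (suc n) ℤ.+ (tail f ⋆ h) n) ℤ.+ (g 0 ℤ.* h (suc n) ℤ.+ (tail g ⋆ h) n) ≡⟨ cong₂ ℤ._+_ (⋆-suc f h n) (⋆-suc g h n) ⟨
    ((f ⋆ h) ⊕ (g ⋆ h)) (suc n)                                            ∎

  scale : ℤ → FPS → FPS
  scale c f n = c ℤ.* f n

  scale-⋆ : ∀ c f g → (scale c f ⋆ g) ≋ scale c (f ⋆ g)
  scale-⋆ c f g zero    = assoc c (f 0) (g 0)
    where
    assoc : ∀ c a b → c ℤ.* a ℤ.* b ℤ.+ + 0 ≡ c ℤ.* (a ℤ.* b ℤ.+ + 0)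
    assoc = solve-∀
  scale-⋆ c f g (suc n) = begin
    (scale c f ⋆ g) (suc n)                              ≡⟨ ⋆-suc (scale c f) g n ⟩
    c ℤ.* f 0 ℤ.* g (suc n) ℤ.+ (scale c (tail f) ⋆ g) n ≡⟨ cong (λ x → c ℤ.* f 0 ℤ.* g (suc n) ℤ.+ x) (scale-⋆ c (tail f) g n) ⟩
    c ℤ.* f 0 ℤ.* g (suc n) ℤ.+ c ℤ.* (tail f ⋆ g) n     ≡⟨ distrib c (f 0) (g (suc n)) ((tail f ⋆ g) n) ⟩
    c ℤ.* (f 0 ℤ.* g (suc n) ℤ.+ (tail f ⋆ g) n)         ≡⟨ cong (c ℤ.*_) (⋆-suc f g n) ⟨
    scale c (f ⋆ g) (suc n)                              ∎
    where
    distrib : ∀ c a b x → c ℤ.* a ℤ.* b ℤ.+ c ℤ.* x ≡ c ℤ.* (a ℤ.* b ℤ.+ x)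
    distrib = solve-∀

  ⋆-assoc : ∀ f g h → ((f ⋆ g) ⋆ h) ≋ (f ⋆ (g ⋆ h))
  ⋆-assoc f g h zero    = assoc (f 0) (g 0) (h 0)
    where
    assoc : ∀ a b c → (a ℤ.* b ℤ.+ + 0) ℤ.* c ℤ.+ + 0 ≡ a ℤ.* (b ℤ.* c ℤ.+ + 0) ℤ.+ + 0
    assoc = solve-∀
  ⋆-assoc f g h (suc n) = begin
    ((f ⋆ g) ⋆ h) (suc n)                                         ≡⟨ ⋆-suc (f ⋆ g) h n ⟩
    (f ⋆ g) 0 ℤ.* h (suc n) ℤ.+ (tail (f ⋆ g) ⋆ h) n              ≡⟨ cong (λ x → (f ⋆ g) 0 ℤ.* h (suc n) ℤ.+ x) tail-step ⟩
    (f ⋆ g) 0 ℤ.* h (suc n) ℤ.+ (f 0 ℤ.* (tail g ⋆ h) n ℤ.+ (tail f ⋆ (g ⋆ h)) n)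
      ≡⟨ regroup (f 0) (g 0) (h (suc n)) ((tail g ⋆ h) n) ((tail f ⋆ (g ⋆ h)) n) ⟩
    f 0 ℤ.* (g 0 ℤ.* h (suc n) ℤ.+ (tail g ⋆ h) n) ℤ.+ (tail f ⋆ (g ⋆ h)) n
      ≡⟨ cong (λ x → f 0 ℤ.* x ℤ.+ (tail f ⋆ (g ⋆ h)) n) (⋆-suc g h n) ⟨
    f 0 ℤ.* (g ⋆ h) (suc n) ℤ.+ (tail f ⋆ (g ⋆ h)) n               ≡⟨ ⋆-suc f (g ⋆ h) n ⟨
    (f ⋆ (g ⋆ h)) (suc n)                                         ∎
    where
    regroup : ∀ a b c x y → (a ℤ.* b ℤ.+ + 0) ℤ.* c ℤ.+ (a ℤ.* x ℤ.+ y) ≡ a ℤ.* (b ℤ.* c ℤ.+ x) ℤ.+ y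
    regroup = solve-∀
    tail-step : (tail (f ⋆ g) ⋆ h) n ≡ f 0 ℤ.* (tail g ⋆ h) n ℤ.+ (tail f ⋆ (g ⋆ h)) n
    tail-step = begin
      (tail (f ⋆ g) ⋆ h) n                                   ≡⟨ ⋆-cong {g = h} (⋆-suc f g) (λ _ → refl) n ⟩
      ((scale (f 0) (tail g) ⊕ (tail f ⋆ g)) ⋆ h) n          ≡⟨ ⋆-distribʳ (scale (f 0) (tail g)) (tail f ⋆ g) h n ⟩
      (scale (f 0) (tail g) ⋆ h) n ℤ.+ ((tail f ⋆ g) ⋆ h) n  ≡⟨ cong₂ ℤ._+_ (scale-⋆ (f 0) (tail g) h n) (⋆-assoc (tail f) g h n) ⟩
      f 0 ℤ.* (tail g ⋆ h) n ℤ.+ (tail f ⋆ (g ⋆ h)) n        ∎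

  0ₛ-⋆ : ∀ f → (0ₛ ⋆ f) ≋ 0ₛ
  0ₛ-⋆ f zero    = refl
  0ₛ-⋆ f (suc n) = trans (⋆-suc 0ₛ f n) (trans (ℤₚ.+-identityˡ _) (0ₛ-⋆ f n))

  1ₛ-⋆ : ∀ f → (1ₛ ⋆ f) ≋ f
  1ₛ-⋆ f zero    = trans (ℤₚ.+-identityʳ (+ 1 ℤ.* f 0)) (ℤₚ.*-identityˡ (f 0))
  1ₛ-⋆ f (suc n) = begin
    (1ₛ ⋆ f) (suc n)                   ≡⟨ ⋆-suc 1ₛ f n ⟩
    + 1 ℤ.* f (suc n) ℤ.+ (0ₛ ⋆ f) n   ≡⟨ cong₂ ℤ._+_ (ℤₚ.*-identityˡ (f (suc n))) (0ₛ-⋆ f n) ⟩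
    f (suc n) ℤ.+ + 0                  ≡⟨ ℤₚ.+-identityʳ (f (suc n)) ⟩
    f (suc n)                          ∎

  FPS-isCommutativeRing : IsCommutativeRing _≋_ _⊕_ _⋆_ negₛ 0ₛ 1ₛ
  FPS-isCommutativeRing = record
    { isRing = record
      { +-isAbelianGroup = record
        { isGroup = record
          { isMonoid = record
            { isSemigroup = record
              { isMagma = record
                { isEquivalence = record { refl = λ _ → refl ; sym = λ p n → sym (p n) ; trans = λ p q n → trans (p n) (q n) }
                ; ∙-cong = λ p q n → cong₂ ℤ._+_ (p n) (q n) }
              ; assoc = λ f g h n → ℤₚ.+-assoc (f n) (g n) (h n) }
            ; identity = (λ f n → ℤₚ.+-identityˡ (f n)) , (λ f n → ℤₚ.+-identityʳ (f n)) }
          ; inverse = (λ f n → ℤₚ.+-inverseˡ (f n)) , (λ f n → ℤₚ.+-inverseʳ (f n))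
          ; ⁻¹-cong = λ p n → cong -_ (p n) }
        ; comm = λ f g n → ℤₚ.+-comm (f n) (g n) }
      ; *-cong = ⋆-cong
      ; *-assoc = ⋆-assoc
      ; *-identity = 1ₛ-⋆ , (λ f n → trans (⋆-comm f 1ₛ n) (1ₛ-⋆ f n))
      ; distrib = (λ f g h n → trans (⋆-comm f (g ⊕ h) n)
                                 (trans (⋆-distribʳ g h f n) (cong₂ ℤ._+_ (⋆-comm g f n) (⋆-comm h f n))))
                , (λ f g h → ⋆-distribʳ g h f) }
    ; *-comm = ⋆-comm }

  FPS-commutativeRing : CommutativeRing 0ℓ 0ℓ
  FPS-commutativeRing = record { isCommutativeRing = FPS-isCommutativeRing }

  constₛ : ℤ → FPS
  constₛ c = poly (c ∷ [])

  constₛ-⋆ : ∀ c f → (constₛ c ⋆ f) ≋ scale c f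
  constₛ-⋆ c f zero    = ℤₚ.+-identityʳ (c ℤ.* f 0)
  constₛ-⋆ c f (suc n) = begin
    (constₛ c ⋆ f) (suc n)            ≡⟨ ⋆-suc (constₛ c) f n ⟩
    c ℤ.* f (suc n) ℤ.+ (0ₛ ⋆ f) n    ≡⟨ cong (λ x → c ℤ.* f (suc n) ℤ.+ x) (0ₛ-⋆ f n) ⟩
    c ℤ.* f (suc n) ℤ.+ + 0           ≡⟨ ℤₚ.+-identityʳ (c ℤ.* f (suc n)) ⟩
    c ℤ.* f (suc n)                   ∎

  FPS-almostCommutativeRing : AlmostCommutativeRing 0ℓ 0ℓ
  FPS-almostCommutativeRing = fromCommutativeRing FPS-commutativeRing

  constₛ-homomorphism : ℤ.+-*-rawRing -Raw-AlmostCommutative⟶ FPS-almostCommutativeRing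
  constₛ-homomorphism = record
    { ⟦_⟧    = constₛ
    ; +-homo = λ { a b zero → refl ; a b (suc n) → refl }
    ; *-homo = λ a b n → sym (trans (constₛ-⋆ a (constₛ b) n) (product a b n))
    ; -‿homo = λ { a zero → refl ; a (suc n) → refl }
    ; 0-homo = λ { zero → refl ; (suc n) → refl }
    ; 1-homo = λ { zero → refl ; (suc n) → refl }
    }
    where
    product : ∀ a b → scale a (constₛ b) ≋ constₛ (a ℤ.* b)
    product a b zero    = refl
    product a b (suc n) = ℤₚ.*-zeroʳ a

  constₛ-≟ : ∀ a b → Maybe (constₛ a ≋ constₛ b)
  constₛ-≟ a b with a ℤ.≟ b
  ... | yes refl = just (λ _ → refl)
  ... | no _     = nothing

  module FPS-Solver = Algebra.Solver.Ring ℤ.+-*-rawRing FPS-almostCommutativeRing constₛ-homomorphism constₛ-≟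

  shift : FPS → FPS
  shift f zero    = + 0
  shift f (suc n) = f n

  X-⋆ : ∀ f → (X ⋆ f) ≋ shift f
  X-⋆ f zero    = refl
  X-⋆ f (suc n) = trans (⋆-suc X f n) (trans (ℤₚ.+-identityˡ _) (1ₛ-⋆ f n))

  poly-linear : ∀ a b → poly (a ∷ b ∷ []) ≋ (constₛ a ⊕ (constₛ b ⋆ X))
  poly-linear a b n = sym (trans (cong (λ x → constₛ a n ℤ.+ x) (constₛ-⋆ b X n)) (coefficient n))
    where
    coefficient : ∀ n → constₛ a n ℤ.+ b ℤ.* X n ≡ poly (a ∷ b ∷ []) n
    coefficient zero          = trans (cong (λ x → a ℤ.+ x) (ℤₚ.*-zeroʳ b)) (ℤₚ.+-identityʳ a)
    coefficient (suc zero)    = trans (ℤₚ.+-identityˡ _) (ℤₚ.*-identityʳ b)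
    coefficient (suc (suc n)) = trans (ℤₚ.+-identityˡ _) (ℤₚ.*-zeroʳ b)

  f⋆g≋0⇒f≋0 : ∀ f g → (f ⋆ g) ≋ 0ₛ → g 0 ≢ + 0 → f ≋ 0ₛ
  f⋆g≋0⇒f≋0 f g fg≋0 g₀≢0 n = vanishes n n ℕₚ.≤-refl
    where
    cancel : ∀ a → a ℤ.* g 0 ≡ + 0 → a ≡ + 0
    cancel a a*g₀≡0 with ℤₚ.i*j≡0⇒i≡0∨j≡0 a a*g₀≡0
    ... | inj₁ a≡0  = a≡0
    ... | inj₂ g₀≡0 = contradiction g₀≡0 g₀≢0
    vanishes : ∀ n → AgreeUpTo n f 0ₛ
    vanishes zero    = AgreeUpTo-zero (cancel (f 0) (trans (sym (ℤₚ.+-identityʳ _)) (fg≋0 0)))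
    vanishes (suc n) = AgreeUpTo-suc (vanishes n) (cancel (f (suc n)) (begin
      f (suc n) ℤ.* g 0                        ≡⟨ ℤₚ.+-identityˡ _ ⟨
      + 0 ℤ.+ f (suc n) ℤ.* g 0                ≡⟨ cong (ℤ._+ f (suc n) ℤ.* g 0) lower-terms ⟨
      (f ⋆ tail g) n ℤ.+ f (suc n) ℤ.* g 0     ≡⟨ ⋆-sucʳ f g n ⟨
      (f ⋆ g) (suc n)                          ≡⟨ fg≋0 (suc n) ⟩
      + 0                                      ∎))
      where
      lower-terms : (f ⋆ tail g) n ≡ + 0
      lower-terms = trans (⋆-agree n {g′ = tail g} (vanishes n) (λ _ _ → refl)) (0ₛ-⋆ (tail g) n)

  θ : FPS → FPS
  θ f n = + n ℤ.* f n

  θ-cong : ∀ {f g} → f ≋ g → θ f ≋ θ g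
  θ-cong f≋g n = cong (+ n ℤ.*_) (f≋g n)

  θ-⊕ : ∀ f g → θ (f ⊕ g) ≋ (θ f ⊕ θ g)
  θ-⊕ f g n = ℤₚ.*-distribˡ-+ (+ n) (f n) (g n)

  θ-1ₛ : θ 1ₛ ≋ 0ₛ
  θ-1ₛ zero    = refl
  θ-1ₛ (suc n) = ℤₚ.*-zeroʳ (+ suc n)

  θ-X : θ X ≋ X
  θ-X zero          = refl
  θ-X (suc zero)    = refl
  θ-X (suc (suc n)) = ℤₚ.*-zeroʳ (+ suc (suc n))

  +suc-* : ∀ n x → + suc n ℤ.* x ≡ + n ℤ.* x ℤ.+ x
  +suc-* n x = trans (cong (ℤ._* x) (ℤₚ.pos-+ 1 n)) (expand (+ n) x)
    where
    expand : ∀ m x → (+ 1 ℤ.+ m) ℤ.* x ≡ m ℤ.* x ℤ.+ x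
    expand = solve-∀

  θ-⋆ : ∀ f g → θ (f ⋆ g) ≋ ((θ f ⋆ g) ⊕ (f ⋆ θ g))
  θ-⋆ f g zero    = vanish (f 0) (g 0)
    where
    vanish : ∀ a b → + 0 ℤ.* (a ℤ.* b ℤ.+ + 0) ≡ (+ 0 ℤ.* a) ℤ.* b ℤ.+ + 0 ℤ.+ (a ℤ.* (+ 0 ℤ.* b) ℤ.+ + 0)
    vanish = solve-∀
  θ-⋆ f g (suc n) = begin
    + suc n ℤ.* (f ⋆ g) (suc n)                         ≡⟨ cong (+ suc n ℤ.*_) (⋆-suc f g n) ⟩
    + suc n ℤ.* (a ℤ.* b ℤ.+ Y)                         ≡⟨ expand (+ suc n) a b Y ⟩
    a ℤ.* (+ suc n ℤ.* b) ℤ.+ + suc n ℤ.* Y             ≡⟨ cong (λ x → a ℤ.* (+ suc n ℤ.* b) ℤ.+ x) (+suc-* n Y) ⟩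
    a ℤ.* (+ suc n ℤ.* b) ℤ.+ (+ n ℤ.* Y ℤ.+ Y)         ≡⟨ cong (λ x → a ℤ.* (+ suc n ℤ.* b) ℤ.+ (x ℤ.+ Y)) (θ-⋆ (tail f) g n) ⟩
    a ℤ.* (+ suc n ℤ.* b) ℤ.+ ((U ℤ.+ W) ℤ.+ Y)         ≡⟨ regroup (+ suc n) a b U W Y ⟩
    (+ 0 ℤ.* a ℤ.* b ℤ.+ (U ℤ.+ Y)) ℤ.+ (a ℤ.* (+ suc n ℤ.* b) ℤ.+ W)
      ≡⟨ cong (λ x → (+ 0 ℤ.* a ℤ.* b ℤ.+ x) ℤ.+ (a ℤ.* (+ suc n ℤ.* b) ℤ.+ W)) tail-θf ⟨
    (+ 0 ℤ.* a ℤ.* b ℤ.+ (tail (θ f) ⋆ g) n) ℤ.+ (a ℤ.* (+ suc n ℤ.* b) ℤ.+ W)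
      ≡⟨ cong₂ ℤ._+_ (⋆-suc (θ f) g n) (⋆-suc f (θ g) n) ⟨
    ((θ f ⋆ g) ⊕ (f ⋆ θ g)) (suc n)                     ∎
    where
    a = f 0
    b = g (suc n)
    Y = (tail f ⋆ g) n
    U = (θ (tail f) ⋆ g) n
    W = (tail f ⋆ θ g) n
    expand : ∀ m a b y → m ℤ.* (a ℤ.* b ℤ.+ y) ≡ a ℤ.* (m ℤ.* b) ℤ.+ m ℤ.* y
    expand = solve-∀
    regroup : ∀ m a b u w y → a ℤ.* (m ℤ.* b) ℤ.+ ((u ℤ.+ w) ℤ.+ y)
                            ≡ (+ 0 ℤ.* a ℤ.* b ℤ.+ (u ℤ.+ y)) ℤ.+ (a ℤ.* (m ℤ.* b) ℤ.+ w)
    regroup = solve-∀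
    tail-θ : tail (θ f) ≋ (θ (tail f) ⊕ tail f)
    tail-θ k = +suc-* k (f (suc k))
    tail-θf : (tail (θ f) ⋆ g) n ≡ U ℤ.+ Y
    tail-θf = trans (⋆-cong {g = g} tail-θ (λ _ → refl) n) (⋆-distribʳ (θ (tail f)) (tail f) g n)

module GeneratingFunctions where

  open PathCounting
  open FormalPowerSeries
  open import Data.Nat as ℕ using (ℕ; zero; suc)
  import Data.Nat.Properties as ℕₚ
  open import Data.Nat.Tactic.RingSolver using (solve-∀)
  open import Data.Integer as ℤ using (+_)
  import Data.Integer.Properties as ℤₚ
  open import Relation.Binary.PropositionalEquality
  open FPS-Solver using (solve; _:=_; _:*_)
  open ≡-Reasoning

  heightSeries : ℕ → FPS
  heightSeries h l = + dyckCount l h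

  -- A path from height h + 1 is a Dyck path, a down step to height h, then a path from height h.
  firstDescent : ∀ n h → AgreeUpTo n (heightSeries (suc h)) (X ⋆ (heightSeries 0 ⋆ heightSeries h))
  firstDescent zero    h = AgreeUpTo-zero refl
  firstDescent (suc n) h = AgreeUpTo-suc (firstDescent n h)
    (trans (coefficient n h (firstDescent n)) (sym (X-⋆ (heightSeries 0 ⋆ heightSeries h) (suc n))))
    where
    H = heightSeries
    coefficient : ∀ n h → (∀ h → AgreeUpTo n (H (suc h)) (X ⋆ (H 0 ⋆ H h))) → H (suc h) (suc n) ≡ (H 0 ⋆ H h) n
    coefficient zero    zero    _  = refl
    coefficient zero    (suc h) _  = refl
    coefficient (suc n) h       IH = begin
      H (suc h) (suc (suc n))                      ≡⟨ ℤₚ.pos-+ (dyckCount (suc n) (suc (suc h))) (dyckCount (suc n) h) ⟩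
      H (suc (suc h)) (suc n) ℤ.+ H h (suc n)
        ≡⟨ cong (ℤ._+ H h (suc n)) (trans (IH (suc h) (suc n) ℕₚ.≤-refl) (X-⋆ (H 0 ⋆ H (suc h)) (suc n))) ⟩
      (H 0 ⋆ H (suc h)) n ℤ.+ H h (suc n)          ≡⟨ cong (ℤ._+ H h (suc n)) reassociate ⟩
      (tail (H 0) ⋆ H h) n ℤ.+ H h (suc n)         ≡⟨ ℤₚ.+-comm ((tail (H 0) ⋆ H h) n) (H h (suc n)) ⟩
      H h (suc n) ℤ.+ (tail (H 0) ⋆ H h) n         ≡⟨ cong (ℤ._+ (tail (H 0) ⋆ H h) n) (ℤₚ.*-identityˡ (H h (suc n))) ⟨
      H 0 0 ℤ.* H h (suc n) ℤ.+ (tail (H 0) ⋆ H h) n ≡⟨ ⋆-suc (H 0) (H h) n ⟨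
      (H 0 ⋆ H h) (suc n)                          ∎
      where
      reassociate : (H 0 ⋆ H (suc h)) n ≡ (tail (H 0) ⋆ H h) n
      reassociate = begin
        (H 0 ⋆ H (suc h)) n
          ≡⟨ ⋆-agree n {f = H 0} {f′ = H 0} {g′ = X ⋆ (H 0 ⋆ H h)} (λ _ _ → refl) (λ m m≤n → IH h m (ℕₚ.m≤n⇒m≤1+n m≤n)) ⟩
        (H 0 ⋆ (X ⋆ (H 0 ⋆ H h))) n
          ≡⟨ solve 3 (λ x a b → a :* (x :* (a :* b)) := (x :* (a :* a)) :* b) (λ _ → refl) X (H 0) (H h) n ⟩
        ((X ⋆ (H 0 ⋆ H 0)) ⋆ H h) n
          ≡⟨ ⋆-agree n {f = X ⋆ (H 0 ⋆ H 0)} {g′ = H h} (λ m m≤n → sym (IH 0 m (ℕₚ.m≤n⇒m≤1+n m≤n))) (λ _ _ → refl) ⟩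
        (tail (H 0) ⋆ H h) n                   ∎

  evenPart : FPS → FPS
  evenPart f k = f (k ℕ.+ k)

  evenPart-⋆ : ∀ f g → (∀ k → f (suc (k ℕ.+ k)) ≡ + 0) → ∀ n → (f ⋆ g) (n ℕ.+ n) ≡ (evenPart f ⋆ evenPart g) n
  evenPart-⋆ f g odd≡0 zero    = refl
  evenPart-⋆ f g odd≡0 (suc n) = begin
    (f ⋆ g) (suc n ℕ.+ suc n)                                          ≡⟨ cong (f ⋆ g) (double-suc n) ⟩
    (f ⋆ g) (suc (suc (n ℕ.+ n)))                                      ≡⟨ ⋆-suc f g (suc (n ℕ.+ n)) ⟩
    f 0 ℤ.* g (suc (suc (n ℕ.+ n))) ℤ.+ (tail f ⋆ g) (suc (n ℕ.+ n))   ≡⟨ cong (λ x → f 0 ℤ.* g (suc (suc (n ℕ.+ n))) ℤ.+ x) odd-term ⟩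
    f 0 ℤ.* g (suc (suc (n ℕ.+ n))) ℤ.+ (tail (tail f) ⋆ g) (n ℕ.+ n)
      ≡⟨ cong₂ (λ a b → f 0 ℤ.* g a ℤ.+ b) (sym (double-suc n))
               (evenPart-⋆ (tail (tail f)) g (λ k → trans (cong f (cong suc (sym (double-suc k)))) (odd≡0 (suc k))) n) ⟩
    f 0 ℤ.* evenPart g (suc n) ℤ.+ (evenPart (tail (tail f)) ⋆ evenPart g) n
      ≡⟨ cong (λ x → f 0 ℤ.* evenPart g (suc n) ℤ.+ x) (⋆-cong {g = evenPart g} (λ k → cong f (sym (double-suc k))) (λ _ → refl) n) ⟩
    f 0 ℤ.* evenPart g (suc n) ℤ.+ (tail (evenPart f) ⋆ evenPart g) n  ≡⟨ ⋆-suc (evenPart f) (evenPart g) n ⟨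
    (evenPart f ⋆ evenPart g) (suc n)                                  ∎
    where
    double-suc : ∀ k → suc k ℕ.+ suc k ≡ suc (suc (k ℕ.+ k))
    double-suc k = cong suc (ℕₚ.+-suc k k)
    odd-term : (tail f ⋆ g) (suc (n ℕ.+ n)) ≡ (tail (tail f) ⋆ g) (n ℕ.+ n)
    odd-term = trans (⋆-suc (tail f) g (n ℕ.+ n))
                     (trans (cong (λ a → a ℤ.* g (suc (n ℕ.+ n)) ℤ.+ (tail (tail f) ⋆ g) (n ℕ.+ n)) (odd≡0 0))
                            (ℤₚ.+-identityˡ _))

  catalanSeries : FPS
  catalanSeries n = + catalan n

  -- catalanSeries is the even part of heightSeries 0, whose odd coefficients vanish.
  catalanSeries-equation : catalanSeries ≋ (1ₛ ⊕ (X ⋆ (catalanSeries ⋆ catalanSeries)))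
  catalanSeries-equation zero    = refl
  catalanSeries-equation (suc m) = begin
    heightSeries 0 (suc m ℕ.+ suc m)                           ≡⟨ cong (heightSeries 0) (cong suc (ℕₚ.+-suc m m)) ⟩
    heightSeries 1 (suc (m ℕ.+ m))                             ≡⟨ firstDescent (suc (m ℕ.+ m)) 0 _ ℕₚ.≤-refl ⟩
    (X ⋆ (heightSeries 0 ⋆ heightSeries 0)) (suc (m ℕ.+ m))    ≡⟨ X-⋆ (heightSeries 0 ⋆ heightSeries 0) (suc (m ℕ.+ m)) ⟩
    (heightSeries 0 ⋆ heightSeries 0) (m ℕ.+ m)
      ≡⟨ evenPart-⋆ (heightSeries 0) (heightSeries 0) (λ k → cong +_ (dyckCount-odd k)) m ⟩
    (catalanSeries ⋆ catalanSeries) m                          ≡⟨ X-⋆ (catalanSeries ⋆ catalanSeries) (suc m) ⟨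
    (X ⋆ (catalanSeries ⋆ catalanSeries)) (suc m)              ≡⟨ ℤₚ.+-identityˡ _ ⟨
    (1ₛ ⊕ (X ⋆ (catalanSeries ⋆ catalanSeries))) (suc m)       ∎

  peakSeries : FPS
  peakSeries n = + dyckTotal n peaks

  SP-dyckTotal : ∀ n → SP n ≡ + dyckTotal n sp
  SP-dyckTotal n = cong +_ (sum-dyckPaths sp n)

  AP-dyckTotal : ∀ n → AP n ≡ + dyckTotal n ap
  AP-dyckTotal n = cong +_ (sum-dyckPaths ap n)

  SP-equation : SP ≋ (X ⋆ ((SP ⊕ peakSeries) ⊕ catalanSeries))
  SP-equation zero    = refl
  SP-equation (suc m) = begin
    SP (suc m)                                                ≡⟨ SP-dyckTotal (suc m) ⟩
    + dyckTotal (suc m) sp                                    ≡⟨ cong +_ (totalSp-suc m) ⟩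
    + (dyckTotal m sp ℕ.+ dyckTotal m peaks ℕ.+ catalan m)    ≡⟨ ℤₚ.pos-+ _ (catalan m) ⟩
    + (dyckTotal m sp ℕ.+ dyckTotal m peaks) ℤ.+ + catalan m  ≡⟨ cong (ℤ._+ + catalan m) (ℤₚ.pos-+ (dyckTotal m sp) _) ⟩
    + dyckTotal m sp ℤ.+ + dyckTotal m peaks ℤ.+ + catalan m  ≡⟨ cong (λ x → x ℤ.+ + dyckTotal m peaks ℤ.+ + catalan m) (SP-dyckTotal m) ⟨
    ((SP ⊕ peakSeries) ⊕ catalanSeries) m                     ≡⟨ X-⋆ ((SP ⊕ peakSeries) ⊕ catalanSeries) (suc m) ⟨
    (X ⋆ ((SP ⊕ peakSeries) ⊕ catalanSeries)) (suc m)         ∎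

  peakSeries-equation : peakSeries ≋ (X ⋆ ((θ catalanSeries ⊕ θ catalanSeries) ⊕ catalanSeries))
  peakSeries-equation zero    = refl
  peakSeries-equation (suc m) = begin
    + dyckTotal (suc m) peaks                             ≡⟨ cong +_ (trans (totalPeaks-suc m) (expand m (catalan m))) ⟩
    + (m ℕ.* catalan m ℕ.+ m ℕ.* catalan m ℕ.+ catalan m) ≡⟨ ℤₚ.pos-+ _ (catalan m) ⟩
    + (m ℕ.* catalan m ℕ.+ m ℕ.* catalan m) ℤ.+ + catalan m
      ≡⟨ cong (ℤ._+ + catalan m) (trans (ℤₚ.pos-+ (m ℕ.* catalan m) _) (cong₂ ℤ._+_ (ℤₚ.pos-* m (catalan m)) (ℤₚ.pos-* m (catalan m)))) ⟩
    ((θ catalanSeries ⊕ θ catalanSeries) ⊕ catalanSeries) m ≡⟨ X-⋆ ((θ catalanSeries ⊕ θ catalanSeries) ⊕ catalanSeries) (suc m) ⟨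
    (X ⋆ ((θ catalanSeries ⊕ θ catalanSeries) ⊕ catalanSeries)) (suc m) ∎
    where
    expand : ∀ m c → suc (m ℕ.+ m) ℕ.* c ≡ m ℕ.* c ℕ.+ m ℕ.* c ℕ.+ c
    expand = solve-∀

  SP⊕AP-equation : (SP ⊕ AP) ≋ peakSeries
  SP⊕AP-equation n = begin
    SP n ℤ.+ AP n                            ≡⟨ cong₂ ℤ._+_ (SP-dyckTotal n) (AP-dyckTotal n) ⟩
    + dyckTotal n sp ℤ.+ + dyckTotal n ap    ≡⟨ ℤₚ.pos-+ (dyckTotal n sp) (dyckTotal n ap) ⟨
    + (dyckTotal n sp ℕ.+ dyckTotal n ap)    ≡⟨ cong +_ (totalSp+totalAp n) ⟩
    peakSeries n                             ∎

module SeriesIdentities where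

  open FormalPowerSeries
  open import Data.Integer as ℤ using (+_; -_)
  import Data.Integer.Properties as ℤₚ
  open import Relation.Binary.PropositionalEquality as ≡ using (_≡_; _≢_)
  open CommutativeRing FPS-commutativeRing
    using (_+_; _*_; _-_; _≈_; 1#; 0#; setoid; +-cong; +-congˡ; +-congʳ; *-cong; *-congˡ; *-congʳ;
           -‿cong; -‿inverseʳ; +-identityˡ; sym; trans; +-abelianGroup)
  open import Algebra.Properties.AbelianGroup +-abelianGroup using (xyx⁻¹≈y)
  open FPS-Solver using (solve; _:=_; _:+_; _:*_; _:-_; con)
  open import Relation.Binary.Reasoning.Setoid setoid

  θ-quadratic : ∀ {F} → F ≈ 1# + X * (F * F) → θ F ≈ X * (F * F) + X * (θ F * F + F * θ F)
  θ-quadratic {F} F≈ = begin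
    θ F                                    ≈⟨ θ-cong F≈ ⟩
    θ (1# + X * (F * F))                   ≈⟨ θ-⊕ 1# (X * (F * F)) ⟩
    θ 1# + θ (X * (F * F))                 ≈⟨ +-cong θ-1ₛ (θ-⋆ X (F * F)) ⟩
    0# + (θ X * (F * F) + X * θ (F * F))   ≈⟨ +-identityˡ (θ X * (F * F) + X * θ (F * F)) ⟩
    θ X * (F * F) + X * θ (F * F)          ≈⟨ +-cong (*-congʳ {F * F} θ-X) (*-congˡ {X} (θ-⋆ F F)) ⟩
    X * (F * F) + X * (θ F * F + F * θ F)  ∎

  quadratic-shift : ∀ {z C} → C ≈ 1# + z * (C * C) → z * (C * C) ≈ C - 1#
  quadratic-shift {z} {C} C≈ = sym (begin
    C - 1#                    ≈⟨ +-congʳ {negₛ 1#} C≈ ⟩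
    1# + z * (C * C) - 1#     ≈⟨ xyx⁻¹≈y 1# (z * (C * C)) ⟩
    z * (C * C)               ∎)

  sqrt-unique : ∀ {C S} → C ≈ 1# + X * (C * C) → IsSqrt1-4z S → S ≈ 1# - (X + X) * C
  sqrt-unique {C} {S} C≈ (S₀≡1 , S²≈) n = ℤₚ.i-j≡0⇒i≡j (S n) (s n) (f⋆g≋0⇒f≋0 (S - s) (S + s) product sum₀≢0 n)
    where
    s = 1# - (X + X) * C
    s² : s * s ≈ poly (+ 1 ∷ - (+ 4) ∷ [])
    s² = begin
      s * s
        ≈⟨ solve 2 (λ x c → (con (+ 1) :- (x :+ x) :* c) :* (con (+ 1) :- (x :+ x) :* c)
                             := con (+ 1) :- (x :+ x :+ x :+ x) :* c :+ (x :+ x :+ x :+ x) :* (x :* (c :* c)))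
                   (λ _ → ≡.refl) X C ⟩
      1# - (X + X + X + X) * C + (X + X + X + X) * (X * (C * C))
        ≈⟨ +-congˡ {1# - (X + X + X + X) * C} (*-congˡ {X + X + X + X} (quadratic-shift {X} C≈)) ⟩
      1# - (X + X + X + X) * C + (X + X + X + X) * (C - 1#)
        ≈⟨ solve 2 (λ x c → con (+ 1) :- (x :+ x :+ x :+ x) :* c :+ (x :+ x :+ x :+ x) :* (c :- con (+ 1))
                             := con (+ 1) :+ con (- (+ 4)) :* x) (λ _ → ≡.refl) X C ⟩
      constₛ (+ 1) + constₛ (- (+ 4)) * X  ≈⟨ poly-linear (+ 1) (- (+ 4)) ⟨
      poly (+ 1 ∷ - (+ 4) ∷ [])            ∎
    product : (S - s) * (S + s) ≈ 0#
    product = begin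
      (S - s) * (S + s) ≈⟨ solve 2 (λ a b → (a :- b) :* (a :+ b) := a :* a :- b :* b) (λ _ → ≡.refl) S s ⟩
      S * S - s * s     ≈⟨ +-cong S²≈ (-‿cong s²) ⟩
      poly (+ 1 ∷ - (+ 4) ∷ []) - poly (+ 1 ∷ - (+ 4) ∷ []) ≈⟨ -‿inverseʳ (poly (+ 1 ∷ - (+ 4) ∷ [])) ⟩
      0#                ∎
    sum₀≢0 : (S + s) 0 ≢ + 0
    sum₀≢0 eq with ≡.trans (≡.sym (≡.cong (ℤ._+ s 0) S₀≡1)) eq
    ... | ()

  sqrt*peaks : ∀ {C Θ P S} → S ≈ 1# - (X + X) * C → Θ ≈ X * (C * C) + X * (Θ * C + C * Θ) → P ≈ X * (Θ + Θ + C) →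
               S * P ≈ X * C
  sqrt*peaks {C} {Θ} {P} {S} S≈ Θ≈ P≈ = begin
    S * P                                         ≈⟨ *-cong S≈ P≈ ⟩
    (1# - (X + X) * C) * (X * (Θ + Θ + C))
      ≈⟨ solve 3 (λ z c t → (con (+ 1) :- (z :+ z) :* c) :* (z :* (t :+ t :+ c))
                            := (z :+ z) :* (t :- z :* (t :* c :+ c :* t)) :+ z :* c :- (z :+ z) :* (z :* (c :* c)))
                 (λ _ → ≡.refl) X C Θ ⟩
    (X + X) * (Θ - X * (Θ * C + C * Θ)) + X * C - (X + X) * (X * (C * C))
      ≈⟨ +-congʳ {negₛ ((X + X) * (X * (C * C)))} (+-congʳ {X * C} (*-congˡ {X + X} Θ-remainder)) ⟩
    (X + X) * (X * (C * C)) + X * C - (X + X) * (X * (C * C))  ≈⟨ xyx⁻¹≈y ((X + X) * (X * (C * C))) (X * C) ⟩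
    X * C                                         ∎
    where
    Θ-remainder : Θ - X * (Θ * C + C * Θ) ≈ X * (C * C)
    Θ-remainder = begin
      Θ - X * (Θ * C + C * Θ)                                  ≈⟨ +-congʳ {negₛ (X * (Θ * C + C * Θ))} Θ≈ ⟩
      X * (C * C) + X * (Θ * C + C * Θ) - X * (Θ * C + C * Θ)
        ≈⟨ solve 2 (λ a b → a :+ b :- b := a) (λ _ → ≡.refl) (X * (C * C)) (X * (Θ * C + C * Θ)) ⟩
      X * (C * C)                                              ∎

  sqrt*sp : ∀ {C P T S} → T ≈ X * (T + P + C) → S * P ≈ X * C → (1# - X) * S * T ≈ X * C * (X + S)
  sqrt*sp {C} {P} {T} {S} T≈ SP≈ = begin
    (1# - X) * S * T       ≈⟨ solve 3 (λ z s t → (con (+ 1) :- z) :* s :* t := s :* (t :- z :* t)) (λ _ → ≡.refl) X S T ⟩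
    S * (T - X * T)        ≈⟨ *-congˡ {S} T-remainder ⟩
    S * (X * (P + C))      ≈⟨ solve 4 (λ z s p c → s :* (z :* (p :+ c)) := z :* (s :* p) :+ z :* c :* s) (λ _ → ≡.refl) X S P C ⟩
    X * (S * P) + X * C * S ≈⟨ +-congʳ {X * C * S} (*-congˡ {X} SP≈) ⟩
    X * (X * C) + X * C * S ≈⟨ solve 3 (λ z s c → z :* (z :* c) :+ z :* c :* s := z :* c :* (z :+ s)) (λ _ → ≡.refl) X S C ⟩
    X * C * (X + S)        ∎
    where
    T-remainder : T - X * T ≈ X * (P + C)
    T-remainder = begin
      T - X * T                  ≈⟨ +-congʳ {negₛ (X * T)} T≈ ⟩
      X * (T + P + C) - X * T    ≈⟨ solve 4 (λ z t p c → z :* (t :+ p :+ c) :- z :* t := z :* (p :+ c)) (λ _ → ≡.refl) X T P C ⟩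
      X * (P + C)                ∎

  sp-identity : ∀ {C T S} → S ≈ 1# - (X + X) * C → S * S ≈ poly (+ 1 ∷ - (+ 4) ∷ []) →
    (1# - X) * S * T ≈ X * C * (X + S) →
    poly (+ 2 ∷ - (+ 2) ∷ []) * S * T ≈ poly (- (+ 1) ∷ + 5 ∷ []) + poly (+ 1 ∷ - (+ 1) ∷ []) * S
  sp-identity {C} {T} {S} S≈ S²≈ ST≈ = begin
    poly (+ 2 ∷ - (+ 2) ∷ []) * S * T       ≈⟨ *-congʳ {T} (*-congʳ {S} (poly-linear (+ 2) (- (+ 2)))) ⟩
    (constₛ (+ 2) + constₛ (- (+ 2)) * X) * S * T
      ≈⟨ solve 3 (λ z s t → (con (+ 2) :+ con (- (+ 2)) :* z) :* s :* t := (con (+ 1) :+ con (+ 1)) :* ((con (+ 1) :- z) :* s :* t))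
                 (λ _ → ≡.refl) X S T ⟩
    (1# + 1#) * ((1# - X) * S * T)          ≈⟨ *-congˡ {1# + 1#} ST≈ ⟩
    (1# + 1#) * (X * C * (X + S))
      ≈⟨ solve 3 (λ z s c → (con (+ 1) :+ con (+ 1)) :* (z :* c :* (z :+ s)) := (con (+ 1) :- (con (+ 1) :- (z :+ z) :* c)) :* (z :+ s))
                 (λ _ → ≡.refl) X S C ⟩
    (1# - (1# - (X + X) * C)) * (X + S)     ≈⟨ *-congʳ {X + S} (+-congˡ {1#} (-‿cong (sym S≈))) ⟩
    (1# - S) * (X + S)
      ≈⟨ solve 2 (λ z s → (con (+ 1) :- s) :* (z :+ s) := z :+ s :- z :* s :- s :* s) (λ _ → ≡.refl) X S ⟩
    X + S - X * S - S * S                   ≈⟨ +-congˡ {X + S - X * S} (-‿cong (trans S²≈ (poly-linear (+ 1) (- (+ 4))))) ⟩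
    X + S - X * S - (constₛ (+ 1) + constₛ (- (+ 4)) * X)
      ≈⟨ solve 2 (λ z s → z :+ s :- z :* s :- (con (+ 1) :+ con (- (+ 4)) :* z)
                          := (con (- (+ 1)) :+ con (+ 5) :* z) :+ (con (+ 1) :+ con (- (+ 1)) :* z) :* s) (λ _ → ≡.refl) X S ⟩
    (constₛ (- (+ 1)) + constₛ (+ 5) * X) + (constₛ (+ 1) + constₛ (- (+ 1)) * X) * S
      ≈⟨ +-cong (poly-linear (- (+ 1)) (+ 5)) (*-congʳ {S} (poly-linear (+ 1) (- (+ 1)))) ⟨
    poly (- (+ 1) ∷ + 5 ∷ []) + poly (+ 1 ∷ - (+ 1) ∷ []) * S ∎

  ap-identity : ∀ {C P T A S} → C ≈ 1# + X * (C * C) → S ≈ 1# - (X + X) * C → S * P ≈ X * C →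
    (1# - X) * S * T ≈ X * C * (X + S) → T + A ≈ P →
    poly (+ 1 ∷ - (+ 1) ∷ []) * S * A ≈ poly (+ 1 ∷ - (+ 3) ∷ []) - poly (+ 1 ∷ - (+ 1) ∷ []) * S
  ap-identity {C} {P} {T} {A} {S} C≈ S≈ SP≈ ST≈ T+A≈ = begin
    poly (+ 1 ∷ - (+ 1) ∷ []) * S * A       ≈⟨ *-cong (*-congʳ {S} (poly-linear (+ 1) (- (+ 1)))) A≈ ⟩
    (constₛ (+ 1) + constₛ (- (+ 1)) * X) * S * (P - T)
      ≈⟨ solve 4 (λ z s p t → (con (+ 1) :+ con (- (+ 1)) :* z) :* s :* (p :- t) := (con (+ 1) :- z) :* (s :* p) :- (con (+ 1) :- z) :* s :* t)
                 (λ _ → ≡.refl) X S P T ⟩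
    (1# - X) * (S * P) - (1# - X) * S * T   ≈⟨ +-cong (*-congˡ {1# - X} SP≈) (-‿cong ST≈) ⟩
    (1# - X) * (X * C) - X * C * (X + S)
      ≈⟨ solve 3 (λ z s c → (con (+ 1) :- z) :* (z :* c) :- z :* c :* (z :+ s) := z :* c :* (con (+ 1) :- z :- z :- s))
                 (λ _ → ≡.refl) X S C ⟩
    X * C * (1# - X - X - S)                ≈⟨ *-congˡ {X * C} (+-congˡ {1# - X - X} (-‿cong S≈)) ⟩
    X * C * (1# - X - X - (1# - (X + X) * C))
      ≈⟨ solve 2 (λ z c → z :* c :* (con (+ 1) :- z :- z :- (con (+ 1) :- (z :+ z) :* c)) := (z :+ z) :* (z :* (c :* c)) :- (z :+ z) :* z :* c)
                 (λ _ → ≡.refl) X C ⟩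
    (X + X) * (X * (C * C)) - (X + X) * X * C ≈⟨ +-congʳ {negₛ ((X + X) * X * C)} (*-congˡ {X + X} (quadratic-shift {X} C≈)) ⟩
    (X + X) * (C - 1#) - (X + X) * X * C
      ≈⟨ solve 2 (λ z c → (z :+ z) :* (c :- con (+ 1)) :- (z :+ z) :* z :* c
                          := (con (+ 1) :+ con (- (+ 3)) :* z) :- (con (+ 1) :+ con (- (+ 1)) :* z) :* (con (+ 1) :- (z :+ z) :* c))
                 (λ _ → ≡.refl) X C ⟩
    (constₛ (+ 1) + constₛ (- (+ 3)) * X) - (constₛ (+ 1) + constₛ (- (+ 1)) * X) * (1# - (X + X) * C)
      ≈⟨ +-cong (poly-linear (+ 1) (- (+ 3))) (-‿cong (*-cong (poly-linear (+ 1) (- (+ 1))) S≈)) ⟨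
    poly (+ 1 ∷ - (+ 3) ∷ []) - poly (+ 1 ∷ - (+ 1) ∷ []) * S ∎
    where
    A≈ : A ≈ P - T
    A≈ = begin
      A           ≈⟨ xyx⁻¹≈y T A ⟨
      T + A - T   ≈⟨ +-congʳ {negₛ T} T+A≈ ⟩
      P - T       ∎

open import Data.Integer using (+_; -_)

corollary2p2 : (S : FPS) → IsSqrt1-4z S →
    ((poly (+ 2 ∷ - (+ 2) ∷ []) ⋆ S) ⋆ SP)
    ≋ (poly (- (+ 1) ∷ + 5 ∷ []) ⊕ (poly (+ 1 ∷ - (+ 1) ∷ []) ⋆ S))
    × ((poly (+ 1 ∷ - (+ 1) ∷ []) ⋆ S) ⋆ AP)
    ≋ (poly (+ 1 ∷ - (+ 3) ∷ []) ⊖ (poly (+ 1 ∷ - (+ 1) ∷ []) ⋆ S))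
corollary2p2 S S-sqrt@(_ , S²≈) =
  sp-identity {C = C} S≈ S²≈ S-sp≈ , ap-identity {C = C} {T = SP} catalanSeries-equation S≈ S-peaks≈ S-sp≈ SP⊕AP-equation
  where
  open FormalPowerSeries
  open GeneratingFunctions
  open SeriesIdentities
  open CommutativeRing FPS-commutativeRing using (_+_; _*_; _-_; _≈_; 1#)
  C = catalanSeries
  S≈ : S ≈ 1# - (X + X) * C
  S≈ = sqrt-unique catalanSeries-equation S-sqrt
  S-peaks≈ : S * peakSeries ≈ X * C
  S-peaks≈ = sqrt*peaks {C = C} S≈ (θ-quadratic catalanSeries-equation) peakSeries-equation
  S-sp≈ : (1# - X) * S * SP ≈ X * C * (X + S)
  S-sp≈ = sqrt*sp {C = C} {P = peakSeries} {S = S} SP-equation S-peaks≈
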